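{- For each $q\in\{17,29\}$ there exists a $(\mathbb{Z}_{27}\times \mathbb{F}_{q},\mathbb{Z}_{27}\times \{0\},9,4)$-DF.
   Context: For an additive group $G$ with a subgroup $N$, a $(G,N,k,\lambda)$ relative difference family (DF) is a multiset $[B_1,\dots,B_r]$ of $k$-subsets of $G$ such that the multiset $\bigcup_{i}[x-y: x,y\in B_i, x\neq y]$ contains every element of $G\setminus N$ exactly $\lambda$ times and no element of $N$. -}

module Defs where

open import Data.Nat using (ℕ; zero; suc; _+_; _∸_; NonZero)
open import Data.Nat.DivMod using (_mod_)
open import Data.Fin using (Fin; toℕ; zero) renaming (_≟_ to _≟ᶠ_)
open import Data.Product using (Σ; _×_; _,_; proj₁; proj₂)
open import Data.Product.Properties using (≡-dec)
open import Data.List using (List; []; _∷_; length; concatMap)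
open import Data.List.Relation.Unary.All using (All)
open import Data.List.Relation.Unary.Unique.Propositional using (Unique)
open import Relation.Binary.Definitions using (DecidableEquality)
open import Relation.Binary.PropositionalEquality using (_≡_; _≢_)
open import Relation.Nullary using (yes; no)

occ : {A : Set} → DecidableEquality A → A → List A → ℕ
occ _≟_ g [] = 0
occ _≟_ g (x ∷ xs) with x ≟ g
... | yes _ = suc (occ _≟_ g xs)
... | no  _ = occ _≟_ g xs

diffs : {A : Set} → DecidableEquality A → (A → A → A) → List A → List A
diffs _≟_ _-_ B =
  concatMap (λ x → concatMap (λ y → dif x y) B) B
  where
  dif : _ → _ → List _
  dif x y with x ≟ y
  ... | yes _ = []
  ... | no  _ = (x - y) ∷ []

allDiffs : {A : Set} → DecidableEquality A → (A → A → A) → List (List A) → List A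
allDiffs _≟_ _-_ Bs = concatMap (diffs _≟_ _-_) Bs

IsRelDF : {A : Set} → DecidableEquality A → (A → A → A) → (N : A → Set) →
          (k lam : ℕ) → List (List A) → Set
IsRelDF _≟_ _-_ N k lam Bs =
  All (λ B → Unique B × length B ≡ k) Bs ×
  (∀ g → (N g → occ _≟_ g (allDiffs _≟_ _-_ Bs) ≡ 0) ×
         ((N g → Data.Empty.⊥) → occ _≟_ g (allDiffs _≟_ _-_ Bs) ≡ lam))
  where import Data.Empty

subMod : (m : ℕ) .{{_ : NonZero m}} → Fin m → Fin m → Fin m
subMod m x y = (toℕ x + (m ∸ toℕ y)) mod m

-- Z_m × Z_n  (for n = q prime, Z_q is the additive group of F_q)
ZZ : ℕ → ℕ → Set
ZZ m n = Fin m × Fin n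

subZZ : (m n : ℕ) .{{_ : NonZero m}} .{{_ : NonZero n}} → ZZ m n → ZZ m n → ZZ m n
subZZ m n (a , b) (c , d) = subMod m a c , subMod n b d

_≟ZZ_ : {m n : ℕ} → DecidableEquality (ZZ m n)
_≟ZZ_ = ≡-dec _≟ᶠ_ _≟ᶠ_

RelDF : (m n k lam : ℕ) .{{_ : NonZero m}} .{{_ : NonZero n}} → Set
RelDF m n k lam =
  Σ (List (List (ZZ m n))) λ Bs →
    IsRelDF _≟ZZ_ (subZZ m n) (λ g → toℕ (proj₂ g) ≡ 0) k lam Bs

module Submission where

-- Each family consists of three base blocks together with their images under (a , b) ↦ (a , μ b)
-- for μ in a cyclic group of multipliers of F_q: ⟨9⟩ of order 8 in F₁₇ and ⟨4⟩ of order 14 in F₂₉.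
-- Being a relative difference family is decidable for an explicit family in a finite group,
-- so the two families are verified by evaluating that decision procedure.

open import Defs
open import Data.Nat using (ℕ; zero; suc; _*_; NonZero)
open import Data.Nat.Base using (nonZero)
open import Data.Nat.DivMod using (_mod_)
import Data.Nat.Properties as ℕ
open import Data.Fin using (Fin; toℕ; #_)
import Data.Fin.Properties as Fin
open import Data.Product using (_×_; _,_; proj₁; proj₂)
open import Data.List using (List; []; _∷_; length; map; concatMap)
open import Data.List.Relation.Unary.All using (all?)
open import Data.List.Relation.Unary.AllPairs using (allPairs?)
open import Data.Empty using (⊥-elim)
open import Relation.Binary.PropositionalEquality using (_≡_)
open import Relation.Nullary using (Dec; yes; no; ¬_; ¬?; map′)
open import Relation.Nullary.Decidable using (_×-dec_; from-yes)
open import Relation.Unary using (Decidable)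

scaleSnd : ∀ {m n} .{{_ : NonZero n}} → Fin n → ZZ m n → ZZ m n
scaleSnd μ (a , b) = a , (toℕ μ * toℕ b) mod _

orbit : ∀ {m n} .{{_ : NonZero n}} → Fin n → ℕ → List (ZZ m n) → List (List (ZZ m n))
orbit μ zero    B = []
orbit μ (suc t) B = B ∷ orbit μ t (map (scaleSnd μ) B)

develop : ∀ {m n} .{{_ : NonZero n}} → Fin n → ℕ → List (List (ZZ m n)) → List (List (ZZ m n))
develop μ t = concatMap (orbit μ t)

byCases? : ∀ {a b c} {A : Set a} {B : Set b} {C : Set c} →
           Dec A → Dec B → Dec C → Dec ((A → B) × (¬ A → C))
byCases? (yes a) B? C? = map′ (λ b → (λ _ → b) , λ ¬a → ⊥-elim (¬a a)) (λ h → proj₁ h a) B?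
byCases? (no ¬a) B? C? = map′ (λ c → (λ a → ⊥-elim (¬a a)) , λ _ → c) (λ h → proj₂ h ¬a) C?

allZZ? : ∀ {m n p} {P : ZZ m n → Set p} → Decidable P → Dec (∀ g → P g)
allZZ? P? = map′ (λ h (a , b) → h a b) (λ h a b → h (a , b))
                 (Fin.all? λ a → Fin.all? λ b → P? (a , b))

occurrences? : ∀ {m n} (lam : ℕ) (L : List (ZZ m n)) →
               Dec (∀ g → (toℕ (proj₂ g) ≡ 0 → occ _≟ZZ_ g L ≡ 0) ×
                          (¬ toℕ (proj₂ g) ≡ 0 → occ _≟ZZ_ g L ≡ lam))
occurrences? lam L =
  allZZ? λ g → byCases? (toℕ (proj₂ g) ℕ.≟ 0) (occ _≟ZZ_ g L ℕ.≟ 0) (occ _≟ZZ_ g L ℕ.≟ lam)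

-- The difference list is passed to occurrences? as one argument, so under call-by-need it is
-- computed once rather than once for every group element.
isRelDF? : ∀ {m n} .{{_ : NonZero m}} .{{_ : NonZero n}} (k lam : ℕ) (Bs : List (List (ZZ m n))) →
           Dec (IsRelDF _≟ZZ_ (subZZ m n) (λ g → toℕ (proj₂ g) ≡ 0) k lam Bs)
isRelDF? {m} {n} k lam Bs =
  all? (λ B → allPairs? (λ x y → ¬? (x ≟ZZ y)) B ×-dec (length B ℕ.≟ k)) Bs
  ×-dec occurrences? lam (allDiffs _≟ZZ_ (subZZ m n) Bs)

family₁₇ : List (List (ZZ 27 17))
family₁₇ = develop (# 9) 8
  ( ((# 23 , # 14) ∷ (# 24 , # 2) ∷ (# 16 , # 15) ∷ (# 21 , # 3) ∷ (# 1 , # 6) ∷ (# 23 , # 16) ∷ (# 8 , # 7) ∷ (# 17 , # 13) ∷ (# 19 , # 9) ∷ [])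
  ∷ ((# 16 , # 8) ∷ (# 1 , # 2) ∷ (# 24 , # 15) ∷ (# 17 , # 16) ∷ (# 9 , # 14) ∷ (# 1 , # 13) ∷ (# 7 , # 4) ∷ (# 19 , # 12) ∷ (# 22 , # 1) ∷ [])
  ∷ ((# 1 , # 13) ∷ (# 25 , # 4) ∷ (# 15 , # 3) ∷ (# 15 , # 6) ∷ (# 4 , # 7) ∷ (# 6 , # 11) ∷ (# 14 , # 0) ∷ (# 1 , # 12) ∷ (# 5 , # 15) ∷ [])
  ∷ [])

family₂₉ : List (List (ZZ 27 29))
family₂₉ = develop (# 4) 14
  ( ((# 5 , # 25) ∷ (# 19 , # 18) ∷ (# 22 , # 26) ∷ (# 5 , # 11) ∷ (# 19 , # 27) ∷ (# 26 , # 4) ∷ (# 10 , # 5) ∷ (# 5 , # 7) ∷ (# 7 , # 19) ∷ [])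
  ∷ ((# 17 , # 8) ∷ (# 8 , # 25) ∷ (# 9 , # 2) ∷ (# 24 , # 27) ∷ (# 20 , # 28) ∷ (# 13 , # 16) ∷ (# 19 , # 12) ∷ (# 23 , # 17) ∷ (# 1 , # 0) ∷ [])
  ∷ ((# 15 , # 18) ∷ (# 13 , # 23) ∷ (# 7 , # 22) ∷ (# 10 , # 16) ∷ (# 17 , # 15) ∷ (# 16 , # 6) ∷ (# 9 , # 1) ∷ (# 8 , # 10) ∷ (# 26 , # 12) ∷ [])
  ∷ [])

lemma2p7 : RelDF 27 17 9 4 × RelDF 27 29 9 4
lemma2p7 = (family₁₇ , from-yes (isRelDF? 9 4 family₁₇))
         , (family₂₉ , from-yes (isRelDF? 9 4 family₂₉))
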